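{- For $n\ge1$, let $G_n^{\mathrm{rad}}$ be the graph on vertex set $\{1,\ldots,n\}$ in which distinct $a,b$ are adjacent iff $\gcd(\operatorname{rad}(a),\operatorname{rad}(b))=1$, where $\operatorname{rad}(a)$ is the product of the distinct primes dividing $a$ (with $\operatorname{rad}(1)=1$). For $c\ge1$ and $k_1,\ldots,k_c\ge2$, let $R^{\mathrm{rad}}_{\mathrm{cop}}(k_1,\ldots,k_c)$ be the least $n$ such that every coloring of $\{1,\ldots,n\}$ with colors $1,\ldots,c$ has a color $i$ whose color class contains a clique of $G_n^{\mathrm{rad}}$ on $k_i$ vertices. Then $R^{\mathrm{rad}}_{\mathrm{cop}}(k_1,\ldots,k_c)=p_{\sum_{i=1}^c(k_i-1)}$, where $p_m$ is the $m$-th prime ($p_1=2$). -}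

module Defs where

open import Data.Nat using (ℕ; zero; suc; _+_; _∸_; _≤_; _<_; _!)
open import Data.Nat.ListAction using (sum; product)
open import Data.Nat.Primality using (Prime; prime?)
open import Data.Nat.Divisibility using (_∣_; _∣?_)
open import Data.Nat.GCD using (gcd)

open import Data.Fin using (Fin; toℕ)
open import Data.List using (List; []; _∷_; filter; upTo; applyUpTo; map; allFin)
open import Data.Maybe using (fromMaybe)
open import Data.Product using (Σ; _×_; ∃)
open import Relation.Nullary using (¬_)
open import Relation.Nullary.Decidable using (_×-dec_)
open import Relation.Binary.PropositionalEquality using (_≡_; _≢_)
open import Function.Definitions using (Injective)

-- rad a = product of the distinct primes dividing a (every prime divisor
-- of a ≥ 1 is ≤ a, so it suffices to scan 0..a); rad 1 = 1 (empty product).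
rad : ℕ → ℕ
rad a = product (filter (λ p → prime? p ×-dec p ∣? a) (upTo (suc a)))

-- the least prime in (n, n! + 1]  (Euclid: such a prime always exists),
-- i.e. the least prime greater than n.
firstOr0 : List ℕ → ℕ
firstOr0 []      = 0
firstOr0 (x ∷ _) = x

nextPrime : ℕ → ℕ
nextPrime n = firstOr0 (filter prime? (applyUpTo (λ i → suc n + i) (n !)))

-- p-th prime, 1-indexed: nthPrime 1 = 2, nthPrime 2 = 3, ...
-- (nthPrime 0 = 1 is a dummy value, never used.)
nthPrime : ℕ → ℕ
nthPrime zero    = 1
nthPrime (suc m) = nextPrime (nthPrime m)

-- vertex j : Fin n of G_n^rad stands for the integer toℕ j + 1 ∈ {1,…,n}
val : ∀ {n} → Fin n → ℕ
val j = suc (toℕ j)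

Adj : ∀ {n} → Fin n → Fin n → Set
Adj a b = (a ≢ b) × (gcd (rad (val a)) (rad (val b)) ≡ 1)

MonoClique : ∀ {n c} → (Fin n → Fin c) → Fin c → ℕ → Set
MonoClique {n} col i k =
  Σ (Fin k → Fin n) λ f →
    Injective _≡_ _≡_ f
    × (∀ j → col (f j) ≡ i)
    × (∀ j j' → j ≢ j' → Adj (f j) (f j'))

RadArrow : (n c : ℕ) → (Fin c → ℕ) → Set
RadArrow n c k = (col : Fin n → Fin c) → ∃ λ i → MonoClique col i (k i)

IsLeast : ℕ → (c : ℕ) → (Fin c → ℕ) → Set
IsLeast R c k = RadArrow R c k × (∀ n → n < R → ¬ RadArrow n c k)

sumMinus1 : (c : ℕ) → (Fin c → ℕ) → ℕ
sumMinus1 c k = sum (map (λ i → k i ∸ 1) (allFin c))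

-- The numbers p₀ = 1, p₁, …, pₘ with m = Σᵢ (kᵢ − 1) have pairwise coprime radicals and lie in
-- {1, …, pₘ}; by the generalised pigeonhole principle, under any colouring some colour i occurs on
-- kᵢ of these m + 1 vertices, and they form a monochromatic clique. Conversely, for n < pₘ label each
-- a ≤ n by a prime factor ℓ(a) (with ℓ(1) = 1). Then ℓ(a) = pⱼ for some j < m and adjacent vertices
-- get different labels. Colour a by the block containing j in a partition of {0, …, m − 1} into
-- blocks of sizes kᵢ − 1: a clique of colour i has distinct labels in block i, so at most kᵢ − 1 vertices.
module Submission where

open import Defs
open import Data.Nat
  using (ℕ; zero; suc; _+_; _*_; _∸_; _≤_; _<_; _!; z≤n; s≤s; s≤s⁻¹; z<s; _<?_; 2+;
         NonZero; NonTrivial; nonTrivial⇒nonZero; nonTrivial⇒≢1; n>1⇒nonTrivial; >-nonZero⁻¹)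
open import Data.Nat.Properties
  using (+-0-commutativeMonoid; ≤-refl; ≤-reflexive; ≤-trans; <-trans; ≤-<-trans; <-≤-trans; <-irrefl;
         <-cmp; <⇒≤; <⇒≢; >⇒≢; ≮⇒≥; ≰⇒>; ≤⇒≯; m≤n⇒m<n∨m≡n; m<n⇒m<1+n; suc-injective;
         +-comm; +-monoˡ-≤; +-cancelˡ-<; m≤m+n; *-identityʳ; m+[n∸m]≡n; m≤n+m∸n; ∸-monoʳ-<; 1≤n!)
open import Data.Nat.ListAction using (sum; product)
open import Data.Nat.ListAction.Properties using (∈⇒∣product)
open import Data.Nat.Divisibility
  using (_∣_; _∣?_; ∣-refl; ∣-trans; ∣⇒≤; ∣1⇒≡1; m∣m*n; ∣m+n∣m⇒∣n; m≤n⇒m!∣n!)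
open import Data.Nat.GCD using (gcd)
open import Data.Nat.Coprimality as Coprime using (Coprime; coprime⇒gcd≡1; gcd≡1⇒coprime; prime⇒coprime)
open import Data.Nat.Primality using (Prime; prime?; prime⇒nonZero; prime⇒irreducible; ¬prime[0]; ¬prime[1])
open import Data.Nat.Primality.Factorisation using (factorise)
open import Algebra.Properties.CommutativeMonoid.Sum +-0-commutativeMonoid
  using (sum-syntax; sum-cong-≗; ∑-distrib-+; sum-replicate-zero)
open import Data.Fin as Fin using (Fin; toℕ; fromℕ<; inject≤; splitAt; _↑ˡ_; _↑ʳ_)
open import Data.Fin.Properties as Finₚ
  using (_≟_; toℕ-fromℕ<; toℕ<n; toℕ-injective; toℕ-cast; inject≤-injective; splitAt⁻¹-↑ˡ; splitAt⁻¹-↑ʳ; pigeonhole)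
open import Data.List using (List; []; _∷_; filter; upTo; applyUpTo; _++_; map; allFin; tabulate; length; lookup)
open import Data.List.Properties using (filter-++; filter-none; filter-accept; upTo-∷ʳ; map-tabulate; length-tabulate)
open import Data.List.Relation.Unary.All as All using (All)
open import Data.List.Relation.Unary.All.Properties using (all-filter; applyUpTo⁺₁)
open import Data.List.Relation.Unary.AllPairs using (_∷_)
open import Data.List.Relation.Unary.Any using (here)
open import Data.List.Relation.Unary.Unique.Propositional using (Unique)
open import Data.List.Relation.Unary.Unique.Propositional.Properties as Unique using (allFin⁺)
open import Data.List.Membership.Propositional.Properties using (∈-lookup; ∈-filter⁺; ∈-upTo⁺)
open import Data.Bool using (true; false; if_then_else_)
open import Data.Product as Product using (Σ; _×_; ∃; _,_; proj₁; proj₂; uncurry)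
open import Data.Sum using (_⊎_; inj₁; inj₂; [_,_]′)
open import Function using (_∘_; id)
open import Function.Definitions using (Injective)
open import Relation.Nullary using (¬_; yes; no; does; contradiction)
open import Relation.Nullary.Decidable using (_×-dec_)
open import Relation.Unary using (Decidable)
open import Relation.Binary using (tri<; tri≈; tri>)
open import Relation.Binary.PropositionalEquality using (_≡_; _≢_; refl; sym; trans; cong; cong₂; subst; subst₂; module ≡-Reasoning)
open ≡-Reasoning

sum-tabulate : ∀ {n} (f : Fin n → ℕ) → sum (tabulate f) ≡ ∑[ i < n ] f i
sum-tabulate {zero}  f = refl
sum-tabulate {suc n} f = cong (f Fin.zero +_) (sum-tabulate (f ∘ Fin.suc))

sum-map-allFin : ∀ c (f : Fin c → ℕ) → sum (map f (allFin c)) ≡ ∑[ i < c ] f i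
sum-map-allFin c f = trans (cong sum (map-tabulate id f)) (sum-tabulate f)

∑-<⇒∃< : ∀ {n} (f g : Fin n → ℕ) → ∑[ i < n ] f i < ∑[ i < n ] g i → ∃ λ i → f i < g i
∑-<⇒∃< {suc n} f g ∑f<∑g with f Fin.zero <? g Fin.zero
... | yes f₀<g₀ = Fin.zero , f₀<g₀
... | no  f₀≮g₀ = Product.map Fin.suc id (∑-<⇒∃< (f ∘ Fin.suc) (g ∘ Fin.suc)
  (+-cancelˡ-< (f Fin.zero) _ _ (<-≤-trans ∑f<∑g (+-monoˡ-≤ _ (≮⇒≥ f₀≮g₀)))))

∑-indicator : ∀ {c} (a : Fin c) → ∑[ i < c ] (if does (a ≟ i) then 1 else 0) ≡ 1
∑-indicator {suc c} Fin.zero    = cong suc (sum-replicate-zero c)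
∑-indicator         (Fin.suc a) = ∑-indicator a

module _ {A : Set} {c : ℕ} (colour : A → Fin c) where

  colourClass : Fin c → List A → List A
  colourClass i = filter (λ x → colour x ≟ i)

  length-colourClass-∷ : ∀ i x xs → length (colourClass i (x ∷ xs))
                           ≡ (if does (colour x ≟ i) then 1 else 0) + length (colourClass i xs)
  length-colourClass-∷ i x xs with does (colour x ≟ i)
  ... | true  = refl
  ... | false = refl

  ∑-length-colourClass : ∀ xs → ∑[ i < c ] length (colourClass i xs) ≡ length xs
  ∑-length-colourClass []       = sum-replicate-zero c
  ∑-length-colourClass (x ∷ xs) = begin
    ∑[ i < c ] length (colourClass i (x ∷ xs))
      ≡⟨ sum-cong-≗ (λ i → length-colourClass-∷ i x xs) ⟩
    ∑[ i < c ] ((if does (colour x ≟ i) then 1 else 0) + length (colourClass i xs))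
      ≡⟨ ∑-distrib-+ (λ i → if does (colour x ≟ i) then 1 else 0) (λ i → length (colourClass i xs)) ⟩
    ∑[ i < c ] (if does (colour x ≟ i) then 1 else 0) + ∑[ i < c ] length (colourClass i xs)
      ≡⟨ cong₂ _+_ (∑-indicator (colour x)) (∑-length-colourClass xs) ⟩
    suc (length xs) ∎

  pigeonhole-colourClass : ∀ (k : Fin c → ℕ) xs → ∑[ i < c ] (k i ∸ 1) < length xs →
                           ∃ λ i → k i ≤ length (colourClass i xs)
  pigeonhole-colourClass k xs ∑<len with ∑-<⇒∃< _ _ (subst (_ <_) (sym (∑-length-colourClass xs)) ∑<len)
  ... | i , lt = i , ≤-trans (m≤n+m∸n (k i) 1) lt

lookup-injective : ∀ {A : Set} {xs : List A} → Unique xs → ∀ {i j} → lookup xs i ≡ lookup xs j → i ≡ j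
lookup-injective (_   ∷ _) {Fin.zero}  {Fin.zero}  _  = refl
lookup-injective (x∉ ∷ _) {Fin.zero}  {Fin.suc j} eq = contradiction eq (All.lookup x∉ (∈-lookup j))
lookup-injective (x∉ ∷ _) {Fin.suc i} {Fin.zero}  eq = contradiction (sym eq) (All.lookup x∉ (∈-lookup i))
lookup-injective (_   ∷ u) {Fin.suc i} {Fin.suc j} eq = cong Fin.suc (lookup-injective u eq)

pigeonhole-injection : ∀ {N c} (k : Fin c → ℕ) (h : Fin N → Fin c) → ∑[ i < c ] (k i ∸ 1) < N →
  ∃ λ i → Σ (Fin (k i) → Fin N) λ f → Injective _≡_ _≡_ f × ∀ j → h (f j) ≡ i
pigeonhole-injection {N} k h ∑<N
  with pigeonhole-colourClass h k (allFin N) (subst (_ <_) (sym (length-tabulate id)) ∑<N)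
... | i , k≤∣C∣ = i , f , f-injective , f-colour
  where
  C : List (Fin N)
  C = colourClass h i (allFin N)
  f : Fin (k i) → Fin N
  f j = lookup C (inject≤ j k≤∣C∣)
  f-injective : Injective _≡_ _≡_ f
  f-injective eq = inject≤-injective _ _ _ _ (lookup-injective (Unique.filter⁺ _ (allFin⁺ N)) eq)
  f-colour : ∀ j → h (f j) ≡ i
  f-colour j = All.lookup (all-filter _ (allFin N)) (∈-lookup (inject≤ j k≤∣C∣))

split∑ : ∀ {c} (g : Fin c → ℕ) → Fin (∑[ i < c ] g i) → Σ (Fin c) (Fin ∘ g)
split∑ {suc c} g x = [ (Fin.zero ,_) , Product.map Fin.suc id ∘ split∑ (g ∘ Fin.suc) ]′ (splitAt (g Fin.zero) x)

join∑ : ∀ {c} (g : Fin c → ℕ) → Σ (Fin c) (Fin ∘ g) → Fin (∑[ i < c ] g i)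
join∑ {suc c} g (Fin.zero  , y) = y ↑ˡ _
join∑ {suc c} g (Fin.suc i , y) = g Fin.zero ↑ʳ join∑ (g ∘ Fin.suc) (i , y)

join∑-split∑ : ∀ {c} (g : Fin c → ℕ) x → join∑ g (split∑ g x) ≡ x
join∑-split∑ {suc c} g x with splitAt (g Fin.zero) x in eq
... | inj₁ y = splitAt⁻¹-↑ˡ eq
... | inj₂ y = trans (cong (g Fin.zero ↑ʳ_) (join∑-split∑ (g ∘ Fin.suc) y)) (splitAt⁻¹-↑ʳ eq)

split∑-injective : ∀ {c} (g : Fin c → ℕ) → Injective _≡_ _≡_ (split∑ g)
split∑-injective g {x} {y} eq = begin
  x                     ≡⟨ join∑-split∑ g x ⟨
  join∑ g (split∑ g x)  ≡⟨ cong (join∑ g) eq ⟩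
  join∑ g (split∑ g y)  ≡⟨ join∑-split∑ g y ⟩
  y                     ∎

cast-injective : ∀ {m n} .(m≡n : m ≡ n) → Injective _≡_ _≡_ (Fin.cast m≡n)
cast-injective m≡n {i} {j} eq = toℕ-injective (begin
  toℕ i                ≡⟨ toℕ-cast m≡n i ⟨
  toℕ (Fin.cast m≡n i) ≡⟨ cong toℕ eq ⟩
  toℕ (Fin.cast m≡n j) ≡⟨ toℕ-cast m≡n j ⟩
  toℕ j                ∎)

Σ-≡-in-fibre : ∀ {A : Set} {B : A → Set} {a b i} {x : B a} {y : B b} (a≡i : a ≡ i) (b≡i : b ≡ i) →
               subst B a≡i x ≡ subst B b≡i y → (a , x) ≡ (b , y)
Σ-≡-in-fibre refl refl refl = refl

rad-prime : ∀ {p} → Prime p → rad p ≡ p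
rad-prime {p} p-prime = begin
  product (filter Q? (upTo (suc p)))                  ≡⟨ cong (product ∘ filter Q?) (upTo-∷ʳ p) ⟨
  product (filter Q? (upTo p ++ p ∷ []))              ≡⟨ cong product (filter-++ Q? (upTo p) (p ∷ [])) ⟩
  product (filter Q? (upTo p) ++ filter Q? (p ∷ []))  ≡⟨ cong₂ (λ xs ys → product (xs ++ ys))
                                                           (filter-none Q? (applyUpTo⁺₁ id p ¬Q))
                                                           (filter-accept Q? (p-prime , ∣-refl)) ⟩
  p * 1                                               ≡⟨ *-identityʳ p ⟩
  p                                                   ∎
  where
  Q? = λ q → prime? q ×-dec q ∣? p
  ¬Q : ∀ {q} → q < p → ¬ (Prime q × q ∣ p)
  ¬Q q<p (q-prime , q∣p) with prime⇒irreducible p-prime q∣p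
  ... | inj₁ refl = ¬prime[1] q-prime
  ... | inj₂ refl = <-irrefl refl q<p

prime∣⇒∣rad : ∀ {p a} → .{{NonZero a}} → Prime p → p ∣ a → p ∣ rad a
prime∣⇒∣rad {p} {a} p-prime p∣a =
  ∈⇒∣product (∈-filter⁺ (λ q → prime? q ×-dec q ∣? a) (∈-upTo⁺ (s≤s (∣⇒≤ p∣a))) (p-prime , p∣a))

prime-divisor : ∀ n → .{{NonTrivial n}} → ∃ λ p → Prime p × p ∣ n
prime-divisor n with factorise n {{nonTrivial⇒nonZero n}}
... | record { factors = [] ; isFactorisation = n≡1 } = contradiction n≡1 nonTrivial⇒≢1
... | record { factors = p ∷ ps ; isFactorisation = n≡∏ ; factorsPrime = p-prime All.∷ _ } =
  p , p-prime , subst (p ∣_) (sym n≡∏) (∈⇒∣product {ns = p ∷ ps} (here refl))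

m≤n⇒m∣n! : ∀ {m n} → .{{NonZero m}} → m ≤ n → m ∣ n !
m≤n⇒m∣n! {suc m} m≤n = ∣-trans (m∣m*n (m !)) (m≤n⇒m!∣n! m≤n)

euclid : ∀ n → .{{NonZero n}} → ∃ λ p → Prime p × n < p × p ≤ n + n !
euclid n with prime-divisor (suc (n !)) {{n>1⇒nonTrivial (s≤s (1≤n! n))}}
... | p , p-prime , p∣1+n! = p , p-prime , ≰⇒> p≰n , p≤n+n!
  where
  instance _ = prime⇒nonZero p-prime
  p≰n : ¬ p ≤ n
  p≰n p≤n = ¬prime[1] (subst Prime (∣1⇒≡1 p∣1) p-prime)
    where p∣1 = ∣m+n∣m⇒∣n (subst (p ∣_) (+-comm 1 (n !)) p∣1+n!) (m≤n⇒m∣n! p≤n)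
  p≤n+n! : p ≤ n + n !
  p≤n+n! = ≤-trans (∣⇒≤ p∣1+n!) (+-monoˡ-≤ (n !) (>-nonZero⁻¹ n))

firstOr0-filter-applyUpTo : ∀ {P : ℕ → Set} (P? : Decidable P) f L {i} → i < L → P (f i) →
  ∃ λ j → firstOr0 (filter P? (applyUpTo f L)) ≡ f j × P (f j) × ∀ {i'} → i' < j → ¬ P (f i')
firstOr0-filter-applyUpTo {P} P? f (suc L) {i} i<1+L Pfi with P? (f 0) | i
... | yes Pf₀ | _     = 0 , refl , Pf₀ , λ ()
... | no ¬Pf₀ | zero  = contradiction Pfi ¬Pf₀
... | no ¬Pf₀ | suc i with firstOr0-filter-applyUpTo P? (f ∘ suc) L (s≤s⁻¹ i<1+L) Pfi
...   | j , first≡fj , Pfj , least = suc j , first≡fj , Pfj , least′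
  where
  least′ : ∀ {i'} → i' < suc j → ¬ P (f i')
  least′ {zero}   _          = ¬Pf₀
  least′ {suc i'} (s≤s i'<j) = least i'<j

record LeastPrimeAbove (n p : ℕ) : Set where
  field
    isPrime : Prime p
    above   : n < p
    least   : ∀ {q} → n < q → q < p → ¬ Prime q

offset<window : ∀ {n q L} → n < q → q < suc n + L → q ∸ suc n < L
offset<window {n} n<q q<1+n+L = +-cancelˡ-< (suc n) _ _ (subst (_< suc n + _) (sym (m+[n∸m]≡n n<q)) q<1+n+L)

leastPrimeAbove-window : ∀ n L {p} → Prime p → n < p → p < suc n + L →
  LeastPrimeAbove n (firstOr0 (filter prime? (applyUpTo (suc n +_) L)))
leastPrimeAbove-window n L {p} p-prime n<p p<1+n+L
  with firstOr0-filter-applyUpTo prime? (suc n +_) L (offset<window n<p p<1+n+L)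
         (subst Prime (sym (m+[n∸m]≡n n<p)) p-prime)
... | j , first≡1+n+j , 1+n+j-prime , least = record
  { isPrime = subst Prime (sym first≡1+n+j) 1+n+j-prime
  ; above   = subst (n <_) (sym first≡1+n+j) (s≤s (m≤m+n n j))
  ; least   = λ n<q q<first → subst (¬_ ∘ Prime) (m+[n∸m]≡n n<q)
                (least (offset<window n<q (subst (_ <_) first≡1+n+j q<first)))
  }

nextPrime-leastPrimeAbove : ∀ n → .{{NonZero n}} → LeastPrimeAbove n (nextPrime n)
nextPrime-leastPrimeAbove n with euclid n
... | p , p-prime , n<p , p≤n+n! = leastPrimeAbove-window n (n !) p-prime n<p (s≤s p≤n+n!)

nthPrime-nonZero : ∀ m → NonZero (nthPrime m)
leastPrimeAbove-nthPrime : ∀ m → LeastPrimeAbove (nthPrime m) (nthPrime (suc m))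

nthPrime-nonZero zero    = _
nthPrime-nonZero (suc m) = prime⇒nonZero (LeastPrimeAbove.isPrime (leastPrimeAbove-nthPrime m))

leastPrimeAbove-nthPrime m = nextPrime-leastPrimeAbove (nthPrime m) {{nthPrime-nonZero m}}

nthPrime-prime : ∀ m → Prime (nthPrime (suc m))
nthPrime-prime m = LeastPrimeAbove.isPrime (leastPrimeAbove-nthPrime m)

nthPrime-<-suc : ∀ m → nthPrime m < nthPrime (suc m)
nthPrime-<-suc m = LeastPrimeAbove.above (leastPrimeAbove-nthPrime m)

nthPrime-mono-< : ∀ {j m} → j < m → nthPrime j < nthPrime m
nthPrime-mono-< {j} {suc m} (s≤s j≤m) with m≤n⇒m<n∨m≡n j≤m
... | inj₁ j<m  = <-trans (nthPrime-mono-< j<m) (nthPrime-<-suc m)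
... | inj₂ refl = nthPrime-<-suc m

nthPrime-mono-≤ : ∀ {j m} → j ≤ m → nthPrime j ≤ nthPrime m
nthPrime-mono-≤ j≤m with m≤n⇒m<n∨m≡n j≤m
... | inj₁ j<m  = <⇒≤ (nthPrime-mono-< j<m)
... | inj₂ refl = ≤-refl

nthPrime-injective : ∀ {i j} → nthPrime i ≡ nthPrime j → i ≡ j
nthPrime-injective {i} {j} eq with <-cmp i j
... | tri< i<j _ _ = contradiction eq (<⇒≢ (nthPrime-mono-< i<j))
... | tri≈ _ i≡j _ = i≡j
... | tri> _ _ j<i = contradiction eq (>⇒≢ (nthPrime-mono-< j<i))

nthPrime-complete : ∀ m {q} → q ≡ 1 ⊎ Prime q → q < nthPrime m → ∃ λ j → j < m × nthPrime j ≡ q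
nthPrime-complete zero    (inj₁ refl)    (s≤s ())
nthPrime-complete zero    (inj₂ q-prime) (s≤s z≤n) = contradiction q-prime ¬prime[0]
nthPrime-complete (suc m) {q} q-unit-or-prime q<pₘ₊₁ with <-cmp q (nthPrime m)
... | tri< q<pₘ _ _ = Product.map id (Product.map m<n⇒m<1+n id) (nthPrime-complete m q-unit-or-prime q<pₘ)
... | tri≈ _ q≡pₘ _ = m , ≤-refl , sym q≡pₘ
... | tri> _ _ pₘ<q with q-unit-or-prime
...   | inj₁ refl    = contradiction pₘ<q (≤⇒≯ (>-nonZero⁻¹ _ {{nthPrime-nonZero m}}))
...   | inj₂ q-prime = contradiction q-prime (LeastPrimeAbove.least (leastPrimeAbove-nthPrime m) pₘ<q q<pₘ₊₁)

rad-nthPrime : ∀ m → rad (nthPrime m) ≡ nthPrime m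
rad-nthPrime zero    = refl
rad-nthPrime (suc m) = rad-prime (nthPrime-prime m)

nthPrime-coprime-< : ∀ {i j} → i < j → Coprime (nthPrime j) (nthPrime i)
nthPrime-coprime-< {i} {suc j} i<j = prime⇒coprime (nthPrime-prime j) {{nthPrime-nonZero i}} (nthPrime-mono-< i<j)

nthPrime-coprime : ∀ {i j} → i ≢ j → Coprime (nthPrime i) (nthPrime j)
nthPrime-coprime {i} {j} i≢j with <-cmp i j
... | tri< i<j _ _ = Coprime.sym (nthPrime-coprime-< i<j)
... | tri≈ _ i≡j _ = contradiction i≡j i≢j
... | tri> _ _ j<i = nthPrime-coprime-< j<i

gcd-rad-nthPrime : ∀ {i j} → i ≢ j → gcd (rad (nthPrime i)) (rad (nthPrime j)) ≡ 1
gcd-rad-nthPrime {i} {j} i≢j rewrite rad-nthPrime i | rad-nthPrime j = coprime⇒gcd≡1 (nthPrime-coprime i≢j)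

primeLabel : ℕ → ℕ
primeLabel (2+ n) = proj₁ (prime-divisor (2+ n))
primeLabel _      = 1

primeLabel-prime : ∀ n → Prime (primeLabel (2+ n))
primeLabel-prime n = proj₁ (proj₂ (prime-divisor (2+ n)))

primeLabel-∣ : ∀ n → primeLabel (2+ n) ∣ 2+ n
primeLabel-∣ n = proj₂ (proj₂ (prime-divisor (2+ n)))

primeLabel-unitOrPrime : ∀ a → primeLabel a ≡ 1 ⊎ Prime (primeLabel a)
primeLabel-unitOrPrime 0      = inj₁ refl
primeLabel-unitOrPrime 1      = inj₁ refl
primeLabel-unitOrPrime (2+ n) = inj₂ (primeLabel-prime n)

primeLabel-≤ : ∀ a → primeLabel (suc a) ≤ suc a
primeLabel-≤ zero    = ≤-refl
primeLabel-≤ (suc n) = ∣⇒≤ (primeLabel-∣ n)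

primeLabel-distinct : ∀ {a b} → suc a ≢ suc b → gcd (rad (suc a)) (rad (suc b)) ≡ 1 →
                      primeLabel (suc a) ≢ primeLabel (suc b)
primeLabel-distinct {zero}  {zero}  a≢b _ _ = a≢b refl
primeLabel-distinct {zero}  {suc b} _ _ 1≡p = ¬prime[1] (subst Prime (sym 1≡p) (primeLabel-prime b))
primeLabel-distinct {suc a} {zero}  _ _ p≡1 = ¬prime[1] (subst Prime p≡1 (primeLabel-prime a))
primeLabel-distinct {suc a} {suc b} _ gcd≡1 p≡q = ¬prime[1] (subst Prime p≡1 p-prime)
  where
  p-prime = primeLabel-prime a
  p≡1 = gcd≡1⇒coprime gcd≡1
    (prime∣⇒∣rad p-prime (primeLabel-∣ a) , prime∣⇒∣rad p-prime (subst (_∣ 2+ b) (sym p≡q) (primeLabel-∣ b)))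

primeLabel-adjacent : ∀ {n} {a b : Fin n} → Adj a b → primeLabel (val a) ≢ primeLabel (val b)
primeLabel-adjacent (a≢b , gcd≡1) = primeLabel-distinct (a≢b ∘ toℕ-injective ∘ suc-injective) gcd≡1

primeLabel-index : ∀ m {n} → n < nthPrime m → (a : Fin n) → ∃ λ j → j < m × nthPrime j ≡ primeLabel (val a)
primeLabel-index m n<pₘ a = nthPrime-complete m (primeLabel-unitOrPrime (val a))
  (≤-<-trans (≤-trans (primeLabel-≤ (toℕ a)) (toℕ<n a)) n<pₘ)

primeLabelIndex : ∀ m {n} → n < nthPrime m → Fin n → Fin m
primeLabelIndex m n<pₘ a = fromℕ< (proj₁ (proj₂ (primeLabel-index m n<pₘ a)))

nthPrime-primeLabelIndex : ∀ m {n} (n<pₘ : n < nthPrime m) a →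
                           nthPrime (toℕ (primeLabelIndex m n<pₘ a)) ≡ primeLabel (val a)
nthPrime-primeLabelIndex m n<pₘ a =
  trans (cong nthPrime (toℕ-fromℕ< (proj₁ (proj₂ (primeLabel-index m n<pₘ a)))))
        (proj₂ (proj₂ (primeLabel-index m n<pₘ a)))

primeLabelIndex-adjacent : ∀ m {n} (n<pₘ : n < nthPrime m) {a b : Fin n} → Adj a b →
                           primeLabelIndex m n<pₘ a ≢ primeLabelIndex m n<pₘ b
primeLabelIndex-adjacent m n<pₘ {a} {b} adj eq = primeLabel-adjacent adj (begin
  primeLabel (val a)                        ≡⟨ nthPrime-primeLabelIndex m n<pₘ a ⟨
  nthPrime (toℕ (primeLabelIndex m n<pₘ a)) ≡⟨ cong (nthPrime ∘ toℕ) eq ⟩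
  nthPrime (toℕ (primeLabelIndex m n<pₘ b)) ≡⟨ nthPrime-primeLabelIndex m n<pₘ b ⟩
  primeLabel (val b)                        ∎)

vertex : ∀ {n} a → .{{NonZero a}} → a ≤ n → Fin n
vertex (suc a) a<n = fromℕ< a<n

val-vertex : ∀ {n} a → .{{_ : NonZero a}} (a≤n : a ≤ n) → val (vertex a a≤n) ≡ a
val-vertex (suc a) a<n = cong suc (toℕ-fromℕ< a<n)

primeVertex : ∀ m → Fin (suc m) → Fin (nthPrime m)
primeVertex m j = vertex (nthPrime (toℕ j)) {{nthPrime-nonZero (toℕ j)}} (nthPrime-mono-≤ (s≤s⁻¹ (toℕ<n j)))

val-primeVertex : ∀ m j → val (primeVertex m j) ≡ nthPrime (toℕ j)
val-primeVertex m j = val-vertex (nthPrime (toℕ j)) {{nthPrime-nonZero (toℕ j)}} _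

primeVertex-injective : ∀ m → Injective _≡_ _≡_ (primeVertex m)
primeVertex-injective m {j} {j'} eq = toℕ-injective (nthPrime-injective (begin
  nthPrime (toℕ j)       ≡⟨ val-primeVertex m j ⟨
  val (primeVertex m j)  ≡⟨ cong val eq ⟩
  val (primeVertex m j') ≡⟨ val-primeVertex m j' ⟩
  nthPrime (toℕ j')      ∎))

primeVertex-adjacent : ∀ m {j j'} → j ≢ j' → Adj (primeVertex m j) (primeVertex m j')
primeVertex-adjacent m {j} {j'} j≢j' =
  j≢j' ∘ primeVertex-injective m ,
  subst₂ (λ a b → gcd (rad a) (rad b) ≡ 1) (sym (val-primeVertex m j)) (sym (val-primeVertex m j'))
    (gcd-rad-nthPrime (j≢j' ∘ toℕ-injective))

nthPrime-radArrow : ∀ c k → RadArrow (nthPrime (sumMinus1 c k)) c k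
nthPrime-radArrow c k col = clique (pigeonhole-injection k (col ∘ primeVertex m) ∑<1+m)
  where
  m = sumMinus1 c k
  ∑<1+m : ∑[ i < c ] (k i ∸ 1) < suc m
  ∑<1+m = s≤s (≤-reflexive (sym (sum-map-allFin c (λ i → k i ∸ 1))))
  clique : (∃ λ i → Σ (Fin (k i) → Fin (suc m)) λ f →
              Injective _≡_ _≡_ f × ∀ j → col (primeVertex m (f j)) ≡ i) →
           ∃ λ i → MonoClique col i (k i)
  clique (i , f , f-injective , f-colour) =
    i , primeVertex m ∘ f , f-injective ∘ primeVertex-injective m , f-colour ,
    λ j j' j≢j' → primeVertex-adjacent m (j≢j' ∘ f-injective)

blockColouring-¬monoClique : ∀ {n c} (k : Fin c → ℕ) → (∀ i → 1 ≤ k i) →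
  (ℓ : Fin n → Fin (∑[ i < c ] (k i ∸ 1))) → (∀ {a b} → Adj a b → ℓ a ≢ ℓ b) →
  ∀ i → ¬ MonoClique (proj₁ ∘ split∑ (λ i → k i ∸ 1) ∘ ℓ) i (k i)
blockColouring-¬monoClique k k≥1 ℓ ℓ-adjacent i (f , _ , f-colour , f-adjacent)
  with pigeonhole (∸-monoʳ-< z<s (k≥1 i))
         (λ j → subst (λ i → Fin (k i ∸ 1)) (f-colour j) (proj₂ (split∑ (λ i → k i ∸ 1) (ℓ (f j)))))
... | a , b , a<b , position≡ = ℓ-adjacent (f-adjacent a b (Finₚ.<⇒≢ a<b))
  (split∑-injective (λ i → k i ∸ 1) (Σ-≡-in-fibre (f-colour a) (f-colour b) position≡))

<nthPrime⇒¬radArrow : ∀ c k → (∀ i → 1 ≤ k i) → ∀ n → n < nthPrime (sumMinus1 c k) → ¬ RadArrow n c k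
<nthPrime⇒¬radArrow c k k≥1 n n<pₘ arrow =
  uncurry (blockColouring-¬monoClique k k≥1 ℓ ℓ-adjacent) (arrow (proj₁ ∘ split∑ (λ i → k i ∸ 1) ∘ ℓ))
  where
  ℓ : Fin n → Fin (∑[ i < c ] (k i ∸ 1))
  ℓ = Fin.cast (sum-map-allFin c (λ i → k i ∸ 1)) ∘ primeLabelIndex (sumMinus1 c k) n<pₘ
  ℓ-adjacent : ∀ {a b} → Adj a b → ℓ a ≢ ℓ b
  ℓ-adjacent adj = primeLabelIndex-adjacent (sumMinus1 c k) n<pₘ adj ∘ cast-injective _

corollary4p2 : (c : ℕ) → 1 ≤ c → (k : Fin c → ℕ) → (∀ i → 2 ≤ k i) →
    IsLeast (nthPrime (sumMinus1 c k)) c k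
corollary4p2 c _ k k≥2 =
  nthPrime-radArrow c k , <nthPrime⇒¬radArrow c k (λ i → <⇒≤ (k≥2 i))
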